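{- For any integers $n$ and $d$ with $1\leq d\leq n-1$: (i) $\alpha_n^d\geq\binom{n-1}{d}$; in particular $\alpha_n^d\geq\frac{(n-d)^d}{d!}$; (ii) $\beta_n^d\geq\phi(n)\binom{n-2}{d-1}$.
   Context: $\mathbb{Z}_n$ is the ring of integers modulo $n$, identified with $\{0,\dots,n-1\}$; a vector $(v_1,\dots,v_d)\in\mathbb{Z}_n^d$ is zero-sum-free if no non-empty subset of its components sums to $0$ in $\mathbb{Z}_n$; $\alpha_n^d$ is the number of such vectors, and $\beta_n^d$ is the number of zero-sum-free $(x_1,\dots,x_d)\in\mathbb{Z}_n^d$ with $\gcd(x_1,\dots,x_d,n)=1$. $\phi$ is Euler's totient function. -}

module Defs where

open import Data.Nat using (ℕ; zero; suc; _+_)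
open import Data.Nat.GCD using (gcd)
open import Data.Nat.Divisibility using (_∣_; _∣?_)
open import Data.Fin using (Fin; toℕ)
open import Data.Fin.Subset using (Subset; Nonempty)
open import Data.Fin.Subset.Properties using (nonempty?)
open import Data.Vec using (Vec; []; _∷_; foldr)
open import Data.List using (List; []; _∷_; map; concatMap; filter; length; upTo)
open import Data.Bool using (Bool; true; false)
open import Relation.Binary.PropositionalEquality using (_≡_)
open import Relation.Nullary using (¬_; Dec; yes; no)
open import Relation.Nullary.Decidable using (¬?; _→-dec_)

-- Elements of ℤ_n are represented by Fin n ≅ {0,…,n-1}; a vector of ℤ_n^d is Vec (Fin n) d.

subsetSum : ∀ {n d} → Subset d → Vec (Fin n) d → ℕ
subsetSum []          []       = 0
subsetSum (true ∷ s)  (x ∷ v)  = toℕ x + subsetSum s v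
subsetSum (false ∷ s) (x ∷ v)  = subsetSum s v

ZeroSumFree : ∀ {n d} → Vec (Fin n) d → Set
ZeroSumFree {n} {d} v = ∀ (s : Subset d) → Nonempty s → ¬ (n ∣ subsetSum s v)

allSubsets? : ∀ {d} {P : Subset d → Set} → (∀ s → Dec (P s)) → Dec (∀ s → P s)
allSubsets? {zero} p? with p? []
... | yes p = yes λ { [] → p }
... | no ¬p = no λ h → ¬p (h [])
allSubsets? {suc d} p? with allSubsets? (λ s → p? (true ∷ s)) | allSubsets? (λ s → p? (false ∷ s))
... | yes pt | yes pf = yes λ { (true ∷ s) → pt s ; (false ∷ s) → pf s }
... | no ¬pt | _      = no λ h → ¬pt (λ s → h (true ∷ s))
... | yes _  | no ¬pf = no λ h → ¬pf (λ s → h (false ∷ s))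

zeroSumFree? : ∀ {n d} (v : Vec (Fin n) d) → Dec (ZeroSumFree v)
zeroSumFree? {n} v = allSubsets? (λ s → nonempty? s →-dec ¬? (n ∣? subsetSum s v))

allFinList : (n : ℕ) → List (Fin n)
allFinList zero    = []
allFinList (suc n) = Data.Fin.zero ∷ map Data.Fin.suc (allFinList n)

allVecs : (n d : ℕ) → List (Vec (Fin n) d)
allVecs n zero    = [] ∷ []
allVecs n (suc d) = concatMap (λ x → map (x ∷_) (allVecs n d)) (allFinList n)

gcdWith : ∀ {n d} → Vec (Fin n) d → ℕ
gcdWith {n} v = foldr _ (λ x g → gcd (toℕ x) g) n v

α : (n d : ℕ) → ℕ
α n d = length (filter zeroSumFree? (allVecs n d))

β : (n d : ℕ) → ℕ
β n d = length (filter (λ v → zeroSumFree? v) (filter (λ v → gcdWith v Data.Nat.≟ 1) (allVecs n d)))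

φ : ℕ → ℕ
φ n = length (filter (λ k → gcd k n Data.Nat.≟ 1) (map suc (upTo n)))

-- A vector a of positive integers with a₁ + ⋯ + a_d < n is zero-sum-free in ℤ_n, since every
-- non-empty subset sum lies in [1, n-1]; such vectors are counted by C(n-1, d).  Multiplying by a
-- unit u of ℤ_n preserves zero-sum-freeness and is injective, so the vectors u·(1, b₂, …, b_d)
-- with u a unit and 1 + b₂ + ⋯ + b_d < n are pairwise distinct, zero-sum-free, have
-- gcd(x₁, …, x_d, n) = 1 because x₁ = u, and number φ(n)·C(n-2, d-1).
module Submission where

open import Defs
open import Data.Bool using (true; false)
open import Data.Fin using (Fin; toℕ)
open import Data.Fin.Properties using (toℕ-fromℕ<)
open import Data.Fin.Subset using (Subset; Nonempty)
open import Data.List using (List; []; _∷_; map; _++_; length; filter; upTo; cartesianProduct)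
open import Data.List.Properties using (length-++; length-map)
open import Data.List.Membership.Propositional using (_∈_)
open import Data.List.Membership.Propositional.Properties
  using (∈-∃++; ∈-++⁺ˡ; ∈-++⁺ʳ; ∈-++⁻; ∈-map⁺; ∈-map⁻; ∈-concatMap⁺; ∈-filter⁺; ∈-filter⁻;
         ∈-upTo⁻; ∈-cartesianProduct⁻)
open import Data.List.Relation.Binary.Disjoint.Propositional using (Disjoint)
open import Data.List.Relation.Binary.Subset.Propositional using (_⊆_)
open import Data.List.Relation.Unary.Any using (here; there)
import Data.List.Relation.Unary.Any as Any
import Data.List.Relation.Unary.All as ListAll
import Data.List.Relation.Unary.All.Properties as ListAll
open import Data.List.Relation.Unary.AllPairs using ([]; _∷_)
open import Data.List.Relation.Unary.Unique.Propositional using (Unique)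
import Data.List.Relation.Unary.Unique.Propositional.Properties as Unique
open import Data.Nat using (ℕ; zero; suc; _+_; _*_; _∸_; _^_; _!; _≤_; _<_; _≤ᵇ_; z≤n; s≤s;
  NonZero; _%_; _/_; _≟_)
open import Data.Nat.Properties
open import Data.Nat.Combinatorics using (_C_; _P_; nCk≡nPk/k!; nCk+nC[k+1]≡[n+1]C[k+1])
open import Data.Nat.Combinatorics.Base using (_P′_)
open import Data.Nat.Combinatorics.Specification using (k!∣nP′k)
open import Data.Nat.Coprimality using (Coprime; coprime-divisor; coprime⇒gcd≡1; gcd≡1⇒coprime;
  1-coprimeTo)
import Data.Nat.Coprimality as Coprime
open import Data.Nat.DivMod using (_mod_; m≡m%n+[m/n]*n; m%n<n; m%n%n≡m%n; %-distribˡ-+;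
  m<n⇒m%n≡m; m*[n/m]≡n)
open import Data.Nat.Divisibility using (_∣_; divides; >⇒∤; ∣-refl; ∣-trans; m%n≡0⇒n∣m;
  n∣m⇒m%n≡0)
open import Data.Nat.GCD using (gcd; gcd[m,n]∣n)
open import Data.Product using (_×_; _,_; proj₁; proj₂)
open import Data.Sum using (inj₁; inj₂)
open import Data.Vec using (Vec; []; _∷_; head; sum; here; there)
open import Data.Vec.Properties using (∷-injectiveˡ; ∷-injectiveʳ)
open import Data.Vec.Relation.Unary.All using (All; []; _∷_)
import Data.Vec.Relation.Unary.All as VecAll
open import Relation.Binary.PropositionalEquality
open import Relation.Nullary using (contradiction)
open import Function using (_∘_)


InjectiveOn : ∀ {A B : Set} → (A → B) → List A → Set
InjectiveOn f xs = ∀ {x y} → x ∈ xs → y ∈ xs → f x ≡ f y → x ≡ y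

Unique∧⊆⇒length≤ : ∀ {A : Set} {xs ys : List A} → Unique xs → xs ⊆ ys → length xs ≤ length ys
Unique∧⊆⇒length≤ {xs = []} _ _ = z≤n
Unique∧⊆⇒length≤ {xs = x ∷ xs} (x∉xs ∷ xs!) xs⊆ys with ∈-∃++ (xs⊆ys (here refl))
... | ys₁ , ys₂ , refl = begin
  suc (length xs)                 ≤⟨ s≤s (Unique∧⊆⇒length≤ xs! xs⊆ys₁++ys₂) ⟩
  suc (length (ys₁ ++ ys₂))       ≡⟨ cong suc (length-++ ys₁) ⟩
  suc (length ys₁ + length ys₂)   ≡⟨ sym (+-suc (length ys₁) (length ys₂)) ⟩
  length ys₁ + length (x ∷ ys₂)   ≡⟨ sym (length-++ ys₁) ⟩
  length (ys₁ ++ x ∷ ys₂)         ∎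
  where
  open ≤-Reasoning
  xs⊆ys₁++ys₂ : xs ⊆ ys₁ ++ ys₂
  xs⊆ys₁++ys₂ y∈xs with ∈-++⁻ ys₁ (xs⊆ys (there y∈xs))
  ... | inj₁ y∈ys₁          = ∈-++⁺ˡ y∈ys₁
  ... | inj₂ (here y≡x)     = contradiction (sym y≡x) (ListAll.lookup x∉xs y∈xs)
  ... | inj₂ (there y∈ys₂)  = ∈-++⁺ʳ ys₁ y∈ys₂

Unique-map⁺ : ∀ {A B : Set} {f : A → B} {xs : List A} →
  InjectiveOn f xs → Unique xs → Unique (map f xs)
Unique-map⁺ {xs = []} _ [] = []
Unique-map⁺ {xs = x ∷ xs} inj (x∉xs ∷ xs!) =
  ListAll.map⁺ (ListAll.tabulate (λ y∈xs fx≡fy →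
    ListAll.lookup x∉xs y∈xs (inj (here refl) (there y∈xs) fx≡fy)))
  ∷ Unique-map⁺ (λ x∈ y∈ → inj (there x∈) (there y∈)) xs!

injectiveOn⇒length≤ : ∀ {A B : Set} (f : A → B) {xs : List A} {ys : List B} →
  Unique xs → InjectiveOn f xs → (∀ {x} → x ∈ xs → f x ∈ ys) → length xs ≤ length ys
injectiveOn⇒length≤ f {xs} xs! inj f[xs]⊆ys = begin
  length xs         ≡⟨ length-map f xs ⟨
  length (map f xs) ≤⟨ Unique∧⊆⇒length≤ (Unique-map⁺ inj xs!) fx∈ys ⟩
  _                 ∎
  where
  open ≤-Reasoning
  fx∈ys : map f xs ⊆ _
  fx∈ys fx∈ with ∈-map⁻ f fx∈
  ... | _ , x∈ , refl = f[xs]⊆ys x∈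

length-cartesianProduct : ∀ {A B : Set} (xs : List A) (ys : List B) →
  length (cartesianProduct xs ys) ≡ length xs * length ys
length-cartesianProduct [] ys = refl
length-cartesianProduct (x ∷ xs) ys =
  trans (length-++ (map (x ,_) ys)) (cong₂ _+_ (length-map _ ys) (length-cartesianProduct xs ys))

∈-allFinList : ∀ n (i : Fin n) → i ∈ allFinList n
∈-allFinList (suc n) Fin.zero    = here refl
∈-allFinList (suc n) (Fin.suc i) = there (∈-map⁺ Fin.suc (∈-allFinList n i))

∈-allVecs : ∀ n d (v : Vec (Fin n) d) → v ∈ allVecs n d
∈-allVecs n zero    []      = here refl
∈-allVecs n (suc d) (x ∷ v) = ∈-concatMap⁺ (λ y → map (y ∷_) (allVecs n d))
  (Any.map (λ { refl → ∈-map⁺ (x ∷_) (∈-allVecs n d v) }) (∈-allFinList n x))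

nPk≡nP′k : ∀ {n k} → k ≤ n → n P k ≡ n P′ k
nPk≡nP′k {n} {k} k≤n with k ≤ᵇ n | ≤⇒≤ᵇ k≤n
... | true | _ = refl

k!*nCk≡nP′k : ∀ {n k} → k ≤ n → k ! * (n C k) ≡ n P′ k
k!*nCk≡nP′k {n} {k} k≤n = begin
  k ! * (n C k)              ≡⟨ cong (k ! *_) (nCk≡nPk/k! k≤n) ⟩
  k ! * ((n P k) / k !)    ≡⟨ cong (λ p → k ! * (p / k !)) (nPk≡nP′k k≤n) ⟩
  k ! * ((n P′ k) / k !)   ≡⟨ m*[n/m]≡n (k!∣nP′k k≤n) ⟩
  n P′ k                   ∎
  where
  open ≡-Reasoning
  instance _ = k !≢0

[1+n∸k]^j≤nP′j : ∀ n {k} j → j ≤ k → (suc n ∸ k) ^ j ≤ n P′ j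
[1+n∸k]^j≤nP′j n zero    _   = ≤-refl
[1+n∸k]^j≤nP′j n (suc j) j<k =
  *-mono-≤ (∸-monoʳ-≤ (suc n) j<k) ([1+n∸k]^j≤nP′j n j (<⇒≤ j<k))

[1+n∸k]^k≤k!*nCk : ∀ {n k} → k ≤ n → (suc n ∸ k) ^ k ≤ k ! * (n C k)
[1+n∸k]^k≤k!*nCk {n} {k} k≤n =
  subst ((suc n ∸ k) ^ k ≤_) (sym (k!*nCk≡nP′k k≤n)) ([1+n∸k]^j≤nP′j n k ≤-refl)

incrementHead : ∀ {d} → Vec ℕ (suc d) → Vec ℕ (suc d)
incrementHead (x ∷ v) = suc x ∷ v

incrementHead-injective : ∀ {d} {v w : Vec ℕ (suc d)} → incrementHead v ≡ incrementHead w → v ≡ w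
incrementHead-injective {v = _ ∷ _} {_ ∷ _} refl = refl

-- The vectors with positive entries and sum at most m, split by whether the head is 1
-- (Pascal's rule).
positiveVecs : ℕ → (d : ℕ) → List (Vec ℕ d)
positiveVecs m       zero    = [] ∷ []
positiveVecs zero    (suc d) = []
positiveVecs (suc m) (suc d) =
  map (1 ∷_) (positiveVecs m d) ++ map incrementHead (positiveVecs m (suc d))

length-positiveVecs : ∀ m d → length (positiveVecs m d) ≡ m C d
length-positiveVecs m       zero    = refl
length-positiveVecs zero    (suc d) = refl
length-positiveVecs (suc m) (suc d) = begin
  length (map (1 ∷_) ones ++ map incrementHead larger)
    ≡⟨ length-++ (map (1 ∷_) ones) ⟩
  length (map (1 ∷_) ones) + length (map incrementHead larger)
    ≡⟨ cong₂ _+_ (length-map _ ones) (length-map _ larger) ⟩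
  length ones + length larger
    ≡⟨ cong₂ _+_ (length-positiveVecs m d) (length-positiveVecs m (suc d)) ⟩
  m C d + m C suc d
    ≡⟨ nCk+nC[k+1]≡[n+1]C[k+1] m d ⟩
  suc m C suc d ∎
  where
  open ≡-Reasoning
  ones : List (Vec ℕ d)
  ones = positiveVecs m d
  larger : List (Vec ℕ (suc d))
  larger = positiveVecs m (suc d)

∈-positiveVecs⁻ : ∀ m {d} {v : Vec ℕ d} → v ∈ positiveVecs m d → All (0 <_) v × sum v ≤ m
∈-positiveVecs⁻ m       {zero}  {[]} _ = [] , z≤n
∈-positiveVecs⁻ (suc m) {suc d} v∈ with ∈-++⁻ (map (1 ∷_) (positiveVecs m d)) v∈
... | inj₁ v∈ones with w , w∈ , refl ← ∈-map⁻ (1 ∷_) v∈ones =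
  let w>0 , Σw≤m = ∈-positiveVecs⁻ m w∈ in (s≤s z≤n ∷ w>0) , s≤s Σw≤m
... | inj₂ v∈larger with _ ∷ w , xw∈ , refl ← ∈-map⁻ incrementHead v∈larger =
  let xw>0 , Σxw≤m = ∈-positiveVecs⁻ m xw∈ in (s≤s z≤n ∷ VecAll.tail xw>0) , s≤s Σxw≤m

positiveVecs-unique : ∀ m d → Unique (positiveVecs m d)
positiveVecs-unique m       zero    = ListAll.[] ∷ []
positiveVecs-unique zero    (suc d) = []
positiveVecs-unique (suc m) (suc d) = Unique.++⁺
  (Unique.map⁺ ∷-injectiveʳ (positiveVecs-unique m d))
  (Unique.map⁺ incrementHead-injective (positiveVecs-unique m (suc d)))
  heads-differ
  where
  heads-differ :
    Disjoint (map (1 ∷_) (positiveVecs m d)) (map incrementHead (positiveVecs m (suc d)))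
  heads-differ (v∈ones , v∈larger) with ∈-map⁻ (1 ∷_) v∈ones | ∈-map⁻ incrementHead v∈larger
  ... | _ , _ , refl | (x ∷ _) , xw∈ , 1∷w≡1+x∷w′ with ∈-positiveVecs⁻ m xw∈
  ...   | (x>0 ∷ _) , _ = <⇒≢ x>0 (suc-injective (∷-injectiveˡ 1∷w≡1+x∷w′))

%≡%⇒∣∸ : ∀ m k n .{{_ : NonZero n}} → m % n ≡ k % n → n ∣ m ∸ k
%≡%⇒∣∸ m k n m%n≡k%n = divides (m / n ∸ k / n) (begin
  m ∸ k
    ≡⟨ cong₂ _∸_ (m≡m%n+[m/n]*n m n) (m≡m%n+[m/n]*n k n) ⟩
  (m % n + m / n * n) ∸ (k % n + k / n * n)
    ≡⟨ cong (λ r → (m % n + m / n * n) ∸ (r + k / n * n)) m%n≡k%n ⟨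
  (m % n + m / n * n) ∸ (m % n + k / n * n)
    ≡⟨ [m+n]∸[m+o]≡n∸o (m % n) (m / n * n) (k / n * n) ⟩
  m / n * n ∸ k / n * n
    ≡⟨ *-distribʳ-∸ n (m / n) (k / n) ⟨
  (m / n ∸ k / n) * n ∎)
  where open ≡-Reasoning

∣∧<⇒≡0 : ∀ {m n} → n ∣ m → m < n → m ≡ 0
∣∧<⇒≡0 {zero}  _   _   = refl
∣∧<⇒≡0 {suc m} n∣m m<n = contradiction n∣m (>⇒∤ m<n)

*-cancelˡ-%-≤ : ∀ {n u a b} .{{_ : NonZero n}} → Coprime n u → b ≤ a → a < n →
  (u * a) % n ≡ (u * b) % n → a ≡ b
*-cancelˡ-%-≤ {n} {u} {a} {b} n⊥u b≤a a<n ua≡ub = ≤-antisym (m∸n≡0⇒m≤n a∸b≡0) b≤a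
  where
  n∣u[a∸b] : n ∣ u * (a ∸ b)
  n∣u[a∸b] = subst (n ∣_) (sym (*-distribˡ-∸ u a b)) (%≡%⇒∣∸ (u * a) (u * b) n ua≡ub)
  a∸b≡0 : a ∸ b ≡ 0
  a∸b≡0 = ∣∧<⇒≡0 (coprime-divisor n⊥u n∣u[a∸b]) (≤-<-trans (m∸n≤m a b) a<n)

*-cancelˡ-% : ∀ {n u a b} .{{_ : NonZero n}} → Coprime n u → a < n → b < n →
  (u * a) % n ≡ (u * b) % n → a ≡ b
*-cancelˡ-% {a = a} {b} n⊥u a<n b<n ua≡ub with ≤-total b a
... | inj₁ b≤a = *-cancelˡ-%-≤ n⊥u b≤a a<n ua≡ub
... | inj₂ a≤b = sym (*-cancelˡ-%-≤ n⊥u a≤b b<n (sym ua≡ub))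

scale : (n : ℕ) .{{_ : NonZero n}} → ℕ → ∀ {d} → Vec ℕ d → Vec (Fin n) d
scale n u []      = []
scale n u (a ∷ v) = (u * a) mod n ∷ scale n u v

toℕ-scale-head : ∀ n .{{_ : NonZero n}} u a {d} (v : Vec ℕ d) →
  toℕ (head (scale n u (a ∷ v))) ≡ (u * a) % n
toℕ-scale-head n u a v = toℕ-fromℕ< (m%n<n (u * a) n)

scale-injective : ∀ {n u d} .{{_ : NonZero n}} → Coprime n u → {v w : Vec ℕ d} →
  sum v < n → sum w < n → scale n u v ≡ scale n u w → v ≡ w
scale-injective n⊥u {[]}    {[]}    _    _    _   = refl
scale-injective {n} {u} n⊥u {a ∷ v} {b ∷ w} Σav<n Σbw<n uav≡ubw = cong₂ _∷_
  (*-cancelˡ-% n⊥u (≤-<-trans (m≤m+n a (sum v)) Σav<n) (≤-<-trans (m≤m+n b (sum w)) Σbw<n) ua≡ub)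
  (scale-injective n⊥u (≤-<-trans (m≤n+m (sum v) a) Σav<n) (≤-<-trans (m≤n+m (sum w) b) Σbw<n)
    (∷-injectiveʳ uav≡ubw))
  where
  open ≡-Reasoning
  ua≡ub : (u * a) % n ≡ (u * b) % n
  ua≡ub = begin
    (u * a) % n          ≡⟨ toℕ-scale-head n u a v ⟨
    toℕ ((u * a) mod n)  ≡⟨ cong toℕ (∷-injectiveˡ uav≡ubw) ⟩
    toℕ ((u * b) mod n)  ≡⟨ toℕ-scale-head n u b w ⟩
    (u * b) % n          ∎

selectedSum : ∀ {d} → Subset d → Vec ℕ d → ℕ
selectedSum []          []      = 0
selectedSum (true ∷ s)  (a ∷ v) = a + selectedSum s v
selectedSum (false ∷ s) (a ∷ v) = selectedSum s v

selectedSum≤sum : ∀ {d} (s : Subset d) (v : Vec ℕ d) → selectedSum s v ≤ sum v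
selectedSum≤sum []          []      = z≤n
selectedSum≤sum (true ∷ s)  (a ∷ v) = +-monoʳ-≤ a (selectedSum≤sum s v)
selectedSum≤sum (false ∷ s) (a ∷ v) = ≤-trans (selectedSum≤sum s v) (m≤n+m (sum v) a)

selectedSum-pos : ∀ {d} (s : Subset d) {v : Vec ℕ d} →
  All (0 <_) v → Nonempty s → 0 < selectedSum s v
selectedSum-pos (true ∷ s)  {a ∷ v} (a>0 ∷ _) (_ , here)      =
  ≤-trans a>0 (m≤m+n a (selectedSum s v))
selectedSum-pos (true ∷ s)  {a ∷ v} (_ ∷ v>0) (_ , there i∈s) =
  ≤-trans (selectedSum-pos s v>0 (_ , i∈s)) (m≤n+m (selectedSum s v) a)
selectedSum-pos (false ∷ s) (_ ∷ v>0) (_ , there i∈s) = selectedSum-pos s v>0 (_ , i∈s)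

subsetSum-scale : ∀ n .{{_ : NonZero n}} u {d} (s : Subset d) (v : Vec ℕ d) →
  subsetSum s (scale n u v) % n ≡ (u * selectedSum s v) % n
subsetSum-scale n u []          []      = cong (_% n) (sym (*-zeroʳ u))
subsetSum-scale n u (false ∷ s) (a ∷ v) = subsetSum-scale n u s v
subsetSum-scale n u (true ∷ s)  (a ∷ v) = begin
  (toℕ ((u * a) mod n) + T) % n   ≡⟨ cong (λ x → (x + T) % n) (toℕ-scale-head n u a v) ⟩
  ((u * a) % n + T) % n           ≡⟨ %-distribˡ-+ ((u * a) % n) T n ⟩
  ((u * a) % n % n + T % n) % n   ≡⟨ cong₂ (λ x y → (x + y) % n) (m%n%n≡m%n (u * a) n)
                                                                 (subsetSum-scale n u s v) ⟩
  ((u * a) % n + (u * S) % n) % n ≡⟨ %-distribˡ-+ (u * a) (u * S) n ⟨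
  (u * a + u * S) % n             ≡⟨ cong (_% n) (*-distribˡ-+ u a S) ⟨
  (u * (a + S)) % n               ∎
  where
  open ≡-Reasoning
  T S : ℕ
  T = subsetSum s (scale n u v)
  S = selectedSum s v

scale-zeroSumFree : ∀ {n u d} .{{_ : NonZero n}} → Coprime n u → {v : Vec ℕ d} →
  All (0 <_) v → sum v < n → ZeroSumFree (scale n u v)
scale-zeroSumFree {n} {u} n⊥u {v} v>0 Σv<n s s≠∅ n∣Σ = <⇒≢ (selectedSum-pos s v>0 s≠∅) (sym S≡0)
  where
  S : ℕ
  S = selectedSum s v
  n∣uS : n ∣ u * S
  n∣uS = m%n≡0⇒n∣m (u * S) n (trans (sym (subsetSum-scale n u s v)) (n∣m⇒m%n≡0 _ n n∣Σ))
  S≡0 : S ≡ 0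
  S≡0 = ∣∧<⇒≡0 (coprime-divisor n⊥u n∣uS) (≤-<-trans (selectedSum≤sum s v) Σv<n)

gcdWith∣n : ∀ {n d} (v : Vec (Fin n) d) → gcdWith v ∣ n
gcdWith∣n []      = ∣-refl
gcdWith∣n (x ∷ v) = ∣-trans (gcd[m,n]∣n (toℕ x) (gcdWith v)) (gcdWith∣n v)

coprime-head⇒gcdWith≡1 : ∀ {n d} (x : Fin n) (v : Vec (Fin n) d) →
  Coprime (toℕ x) n → gcdWith (x ∷ v) ≡ 1
coprime-head⇒gcdWith≡1 x v x⊥n =
  coprime⇒gcd≡1 (λ (d∣x , d∣gcd) → x⊥n (d∣x , ∣-trans d∣gcd (gcdWith∣n v)))

totatives : ℕ → List ℕ
totatives n = filter (λ k → gcd k n ≟ 1) (map suc (upTo n))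

totatives-unique : ∀ n → Unique (totatives n)
totatives-unique n = Unique.filter⁺ _ (Unique.map⁺ suc-injective (Unique.upTo⁺ n))

∈-totatives⁻ : ∀ {k u} → u ∈ totatives (suc (suc k)) → Coprime u (suc (suc k)) × u < suc (suc k)
∈-totatives⁻ {k} u∈ with ∈-filter⁻ (λ j → gcd j (suc (suc k)) ≟ 1) {xs = map suc (upTo _)} u∈
... | u∈[1,n] , gcd≡1 with ∈-map⁻ suc u∈[1,n]
... | j , j∈ , refl with m≤n⇒m<n∨m≡n (∈-upTo⁻ j∈)
...   | inj₁ u<n = gcd≡1⇒coprime gcd≡1 , u<n
...   | inj₂ refl = contradiction (gcd≡1⇒coprime gcd≡1 {suc (suc k)} (∣-refl , ∣-refl)) λ ()

nCd≤α : ∀ m d → m C d ≤ α (suc m) d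
nCd≤α m d = subst (_≤ α (suc m) d) (length-positiveVecs m d)
  (injectiveOn⇒length≤ (scale (suc m) 1) (positiveVecs-unique m d)
    (λ v∈ w∈ → scale-injective n⊥1 (Σ<n v∈) (Σ<n w∈))
    (λ v∈ → ∈-filter⁺ zeroSumFree? (∈-allVecs (suc m) d _)
               (scale-zeroSumFree n⊥1 (proj₁ (∈-positiveVecs⁻ m v∈)) (Σ<n v∈))))
  where
  n⊥1 : Coprime (suc m) 1
  n⊥1 = Coprime.sym (1-coprimeTo (suc m))
  Σ<n : ∀ {v} → v ∈ positiveVecs m d → sum v < suc m
  Σ<n v∈ = s≤s (proj₂ (∈-positiveVecs⁻ m v∈))

unitMultiple : ∀ n .{{_ : NonZero n}} {d} → ℕ × Vec ℕ d → Vec (Fin n) (suc d)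
unitMultiple n (u , b) = scale n u (1 ∷ b)

toℕ-head-unitMultiple : ∀ {n u d} .{{_ : NonZero n}} → u < n → (b : Vec ℕ d) →
  toℕ (head (unitMultiple n (u , b))) ≡ u
toℕ-head-unitMultiple {n} {u} u<n b = begin
  toℕ (head (unitMultiple n (u , b)))  ≡⟨ toℕ-scale-head n u 1 b ⟩
  (u * 1) % n                          ≡⟨ cong (_% n) (*-identityʳ u) ⟩
  u % n                                ≡⟨ m<n⇒m%n≡m u<n ⟩
  u                                    ∎
  where open ≡-Reasoning

module _ (k d : ℕ) where

  private
    n : ℕ
    n = suc (suc k)

    pairs : List (ℕ × Vec ℕ d)
    pairs = cartesianProduct (totatives n) (positiveVecs k d)

    Σ<n : ∀ {b} → b ∈ positiveVecs k d → sum (1 ∷ b) < n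
    Σ<n b∈ = s≤s (s≤s (proj₂ (∈-positiveVecs⁻ k b∈)))

  unitMultiple-injectiveOn : InjectiveOn (unitMultiple n) pairs
  unitMultiple-injectiveOn {u , b} {u′ , b′} ub∈ ub′∈ eq
    with u∈ , b∈ ← ∈-cartesianProduct⁻ (totatives n) _ ub∈
       | u′∈ , b′∈ ← ∈-cartesianProduct⁻ (totatives n) _ ub′∈
    with refl ← trans (sym (toℕ-head-unitMultiple (proj₂ (∈-totatives⁻ u∈)) b))
                  (trans (cong (toℕ ∘ head) eq)
                         (toℕ-head-unitMultiple (proj₂ (∈-totatives⁻ u′∈)) b′))
    = cong (u ,_) (∷-injectiveʳ
        (scale-injective (Coprime.sym (proj₁ (∈-totatives⁻ u∈))) (Σ<n b∈) (Σ<n b′∈) eq))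

  unitMultiple-zeroSumFree∧gcdWith≡1 : ∀ {ub} → ub ∈ pairs →
    ZeroSumFree (unitMultiple n ub) × gcdWith (unitMultiple n ub) ≡ 1
  unitMultiple-zeroSumFree∧gcdWith≡1 {u , b} ub∈
    with u∈ , b∈ ← ∈-cartesianProduct⁻ (totatives n) _ ub∈
    with u⊥n , u<n ← ∈-totatives⁻ u∈
    = scale-zeroSumFree (Coprime.sym u⊥n) (s≤s z≤n ∷ proj₁ (∈-positiveVecs⁻ k b∈)) (Σ<n b∈)
    , coprime-head⇒gcdWith≡1 _ (scale n u b)
        (subst (λ x → Coprime x n) (sym (toℕ-head-unitMultiple u<n b)) u⊥n)

  φ*nCd≤β : φ n * (k C d) ≤ β n (suc d)
  φ*nCd≤β = subst (_≤ β n (suc d)) length-pairs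
    (injectiveOn⇒length≤ (unitMultiple n)
      (Unique.cartesianProduct⁺ (totatives-unique n) (positiveVecs-unique k d))
      unitMultiple-injectiveOn
      λ ub∈ → let zsf , gcd≡1 = unitMultiple-zeroSumFree∧gcdWith≡1 ub∈ in
        ∈-filter⁺ (λ v → zeroSumFree? v)
          (∈-filter⁺ (λ v → gcdWith v ≟ 1) (∈-allVecs n (suc d) _) gcd≡1) zsf)
    where
    length-pairs : length pairs ≡ φ n * (k C d)
    length-pairs =
      trans (length-cartesianProduct (totatives n) _) (cong (φ n *_) (length-positiveVecs k d))

proposition5p4 : ∀ (n d : ℕ) → 1 ≤ d → d ≤ n ∸ 1 →
    ((n ∸ 1) C d ≤ α n d × (n ∸ d) ^ d ≤ d ! * α n d)
    × (φ n * ((n ∸ 2) C (d ∸ 1)) ≤ β n d)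
proposition5p4 (suc (suc k)) (suc d) _ d≤n∸1 =
    (nCd≤α (suc k) (suc d)
  , ≤-trans ([1+n∸k]^k≤k!*nCk d≤n∸1) (*-monoʳ-≤ (suc d !) (nCd≤α (suc k) (suc d))))
  , φ*nCd≤β k d
proposition5p4 zero          (suc d) _ ()
proposition5p4 (suc zero)    (suc d) _ ()
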